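{- The following are equivalent: (1) $\mathsf{WF}_{b4}^i$, i.e. given $(A_i)$, an infinite sequence of sets, and $(f_i)$, a corresponding sequence of injections $f_i : A_{i+1} \to A_i$, there is some $n \in \mathbb{N}$ such that $|A_n| = |A_{n+1}|$. (2) Given an infinite nested sequence of sets $B_0 \supseteq B_1 \supseteq B_2 \supseteq \cdots$, there is some $n \in \mathbb{N}$ such that $|B_n| = |B_{n+1}|$.
   Context: Work in $\mathsf{ZF}$. $|X|=|Y|$ means there is a bijection between $X$ and $Y$. -}

module Defs where

open import Level using (Level)
open import Data.Nat using (ℕ; suc)
open import Data.Product using (Σ; ∃; _×_)
open import Function.Bundles using (_↣_; _↔_)
open import Relation.Unary using (Pred; _⊆_; Irrelevant)
open import Axiom.UniquenessOfIdentityProofs using (UIP)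

-- ZF sets are modelled as h-sets: types satisfying UIP.
-- Subsets of a set A are propositional predicates on A; |B| is Σ A B.

WFb4i : (ℓ : Level) → Set (Level.suc ℓ)
WFb4i ℓ =
  (A : ℕ → Set ℓ) → (∀ i → UIP (A i)) →
  (f : ∀ i → A (suc i) ↣ A i) →
  ∃ λ n → A n ↔ A (suc n)

WFnested : (ℓ : Level) → Set (Level.suc ℓ)
WFnested ℓ =
  (A : Set ℓ) → UIP A →
  (B : ℕ → Pred A ℓ) → (∀ n → Irrelevant (B n)) →
  (∀ n → B (suc n) ⊆ B n) →
  ∃ λ n → Σ A (B n) ↔ Σ A (B (suc n))

-- A nested sequence B₀ ⊇ B₁ ⊇ ⋯ is a sequence of injections (the inclusions).
-- Conversely, injections fₙ : Aₙ₊₁ → Aₙ compose to injections Aₙ → A₀, whose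
-- images form a nested sequence of subsets of A₀ with |image| = |Aₙ|.  Working
-- with h-sets is what makes subtypes and images propositional subsets.
module Submission where

open import Level using (Level; _⊔_)
open import Data.Nat using (ℕ; zero; suc)
open import Data.Product using (Σ; _,_; proj₁; proj₂; map₂)
open import Function.Bundles using (_⇔_; _↣_; _↔_; mk⇔; mk↣; mk↔ₛ′; Injection)
open import Function.Construct.Identity using (↣-id)
open import Function.Construct.Composition using (_↣-∘_)
open import Function.Properties.Inverse using (↔-trans; ↔-sym)
open import Relation.Unary using (Pred; _⊆_; Irrelevant)
open import Relation.Binary.PropositionalEquality using (_≡_; refl; sym; trans; cong)
open import Axiom.UniquenessOfIdentityProofs using (UIP; module Constant⇒UIP)

open import Defs

module _ {a p} {A : Set a} {P : Pred A p} (P-irrelevant : Irrelevant P) where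

  Σ-≡-from-proj₁ : {x y : Σ A P} → proj₁ x ≡ proj₁ y → x ≡ y
  Σ-≡-from-proj₁ {x , px} {.x , py} refl = cong (x ,_) (P-irrelevant px py)

  Σ-UIP : UIP A → UIP (Σ A P)
  Σ-UIP uip = Constant⇒UIP.≡-irrelevant canonical canonical-constant
    where
    canonical : {x y : Σ A P} → x ≡ y → x ≡ y
    canonical eq = Σ-≡-from-proj₁ (cong proj₁ eq)

    canonical-constant : {x y : Σ A P} (p q : x ≡ y) → canonical p ≡ canonical q
    canonical-constant p q = cong Σ-≡-from-proj₁ (uip (cong proj₁ p) (cong proj₁ q))

  ⊆⇒Σ-↣ : ∀ {q} {Q : Pred A q} → P ⊆ Q → Σ A P ↣ Σ A Q
  ⊆⇒Σ-↣ P⊆Q = mk↣ {to = map₂ P⊆Q} (λ eq → Σ-≡-from-proj₁ (cong proj₁ eq))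

module _ {a b} {A : Set a} {B : Set b} (f : A ↣ B) where
  open Injection f using (to; injective)

  Image : Pred B (a ⊔ b)
  Image y = Σ A λ x → to x ≡ y

  Image-irrelevant : UIP B → Irrelevant Image
  Image-irrelevant uip (x , p) (_ , q) with injective (trans p (sym q))
  ... | refl = cong (x ,_) (uip p q)

  corestrict : A → Σ B Image
  corestrict x = to x , x , refl

  ↔Σ-Image : A ↔ Σ B Image
  ↔Σ-Image = mk↔ₛ′ corestrict (λ (_ , x , _) → x) corestrict-onto (λ _ → refl)
    where
    corestrict-onto : (y : Σ B Image) → corestrict (proj₁ (proj₂ y)) ≡ y
    corestrict-onto (_ , x , refl) = refl

Image-∘-⊆ : ∀ {a b c} {A : Set a} {B : Set b} {C : Set c} (f : A ↣ B) (g : C ↣ A) →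
            Image (f ↣-∘ g) ⊆ Image f
Image-∘-⊆ f g (z , fgz) = Injection.to g z , fgz

compose-↣ : ∀ {ℓ} {A : ℕ → Set ℓ} → (∀ i → A (suc i) ↣ A i) → ∀ n → A n ↣ A 0
compose-↣ {A = A} f zero    = ↣-id (A 0)
compose-↣         f (suc n) = compose-↣ f n ↣-∘ f n

WFb4i⇒WFnested : (ℓ : Level) → WFb4i ℓ → WFnested ℓ
WFb4i⇒WFnested ℓ wf A uip B B-irrelevant B-nested =
  wf (λ n → Σ A (B n))
     (λ n → Σ-UIP (B-irrelevant n) uip)
     (λ n → ⊆⇒Σ-↣ (B-irrelevant (suc n)) (B-nested n))

WFnested⇒WFb4i : (ℓ : Level) → WFnested ℓ → WFb4i ℓ
WFnested⇒WFb4i ℓ wf A uip f =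
  map₂ via-images
    (wf (A 0) (uip 0) (λ n → Image (g n))
        (λ n → Image-irrelevant (g n) (uip 0))
        (λ n → Image-∘-⊆ (g n) (f n)))
  where
  g : ∀ n → A n ↣ A 0
  g = compose-↣ f

  via-images : ∀ {n} → Σ (A 0) (Image (g n)) ↔ Σ (A 0) (Image (g (suc n))) → A n ↔ A (suc n)
  via-images {n} e = ↔-trans (↔Σ-Image (g n)) (↔-trans e (↔-sym (↔Σ-Image (g (suc n)))))

proposition4p3 : (ℓ : Level) → WFb4i ℓ ⇔ WFnested ℓ
proposition4p3 ℓ = mk⇔ (WFb4i⇒WFnested ℓ) (WFnested⇒WFb4i ℓ)
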